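{- Let $\mathcal{D}^h$ (high-level) and $\mathcal{D}^l$ (low-level) be basic action theories and $m$ a refinement mapping from $\mathcal{D}^h$ to $\mathcal{D}^l$. Then $\mathcal{D}^h$ is a sound abstraction of $\mathcal{D}^l$ relative to $m$ if and only if all of the following hold: (a) $\mathcal{D}^l_{S_0}\cup\mathcal{D}^l_{ca}\cup\mathcal{D}^l_{coa}\models m(\phi)$ for every $\phi\in\mathcal{D}^h_{S_0}$; (b) $\mathcal{D}^l\cup\mathcal{C}\models\forall s.\,Do(\textsc{anyseqhl},S_0,s)\supset\bigwedge_{A_i\in\mathcal{A}^h}\forall\vec x.\,\big(m(\phi^{Poss}_{A_i}(\vec x))[s]\equiv\exists s'.\,Do(m(A_i(\vec x)),s,s')\big)$; (c) $\mathcal{D}^l\cup\mathcal{C}\models\forall s.\,Do(\textsc{anyseqhl},S_0,s)\supset\bigwedge_{A_i\in\mathcal{A}^h}\forall\vec x,s'.\,\Big(Do(m(A_i(\vec x)),s,s')\supset\bigwedge_{F_i\in\mathcal{F}^h}\forall\vec y\,\big(m(\phi^{ssa}_{F_i,A_i}(\vec y,\vec x))[s]\equiv m(F_i(\vec y))[s']\big)\Big)$, where $\phi^{Poss}_{A_i}(\vec x)$ is the (situation-suppressed) right-hand side of the precondition axiom of $A_i(\vec x)$ in $\mathcal{D}^h$, and $\phi^{ssa}_{F_i,A_i}(\vec y,\vec x)$ is the (situation-suppressed) right-hand side of the successor state axiom of $F_i$ in $\mathcal{D}^h$ instantiated with action $A_i(\vec x)$, with action terms eliminated using $\mathcal{D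}^h_{ca}$.
   Context: Situation calculus setting. The object sort consists of a countably infinite set $\mathcal{N}$ of standard names (unique names and domain closure for objects); there are no function symbols other than constants and no non-fluent predicates. Situations are built from the initial situation $S_0$ with $do(a,s)$; $do([a_1,\dots,a_n],s)$ abbreviates $do(a_n,\dots,do(a_1,s)\dots)$, also written $do(\vec a,s)$; $\epsilon$ is the empty sequence. Fluents are predicates whose last argument is a situation. $Poss(a,s)$ means $a$ is executable in $s$; $Executable(s)$ means every action along the history from $S_0$ to $s$ was possible in the situation where it was performed; $s<s'$ means $s'$ is obtained from $s$ by a nonempty sequence of actions each possible where performed, and $s\le s'$ means $s=s'\lor s<s'$. A formula is uniform in $s$ if it does not mention $Poss$ or the predecessor relation $\sqsubset$, does not quantify over situations, does not use equality on situations, and the only situation term in fluent situation-argument positions is $s$. A basic action theory (BAT) $\mathcal{D}$ over a finite set $\mathcal{A}$ of action types and a finite set $\mathcal{F}$ of fluents is the union of: $\mathcal{D}_{S_0}$ (first-order axioms about $S_0$); $\mathcal{D}_{poss}$, one axiom $Poss(A(\vec x),s)\equiv\phi^{Poss}_A(\vec x,s)$ per action type, $\phi^{Poss}_A$ uniform in $s$; $\mathcal{D}_{ssa}$, one successor state axiom $F(\vec x,do(a,s))\equiv\phi^{ssa}_F(\vec x,a,s)$ per fluent, right-hand side uniform in $s$; $\mathcal{D}_{ca}$, unique names axioms for actions and domain closure on action types; $\mathcal{D}_{coa}$, second-order unique names and domain closure for the object constants in $\mathcal{N}$; and $\Sigma$, the standard (second-order) foundational axioms of the situation calculus. A situation-suppressed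 formula is one with the situation arguments of fluents omitted; $\phi[s]$ restores $s$ as the situation argument of all fluents in $\phi$. ConGolog programs: $\delta::=\alpha\mid\varphi?\mid\delta_1;\delta_2\mid\delta_1|\delta_2\mid\pi x.\delta\mid\delta^*\mid\delta_1\|\delta_2$ (primitive action, test of a situation-suppressed formula, sequence, nondeterministic choice, nondeterministic choice of argument, iteration, interleaved concurrency); $nil$ abbreviates $True?$. Programs are encoded as terms, and $\mathcal{C}$ denotes the axioms: $Trans(\alpha,s,\delta',s')\equiv s'=do(\alpha,s)\land Poss(\alpha,s)\land\delta'=True?$; $Trans(\varphi?,s,\delta',s')\equiv False$; $Trans(\delta_1;\delta_2,s,\delta',s')\equiv\exists\delta_1'(Trans(\delta_1,s,\delta_1',s')\land\delta'=\delta_1';\delta_2)\lor(Final(\delta_1,s)\land Trans(\delta_2,s,\delta',s'))$; $Trans(\delta_1|\delta_2,s,\delta',s')\equiv Trans(\delta_1,s,\delta',s')\lor Trans(\delta_2,s,\delta',s')$; $Trans(\pi x.\delta,s,\delta',s')\equiv\exists x.Trans(\delta,s,\delta',s')$; $Trans(\delta^*,s,\delta',s')\equiv\exists\delta''(Trans(\delta,s,\delta'',s')\land\delta'=\delta'';\delta^*)$; $Trans(\delta_1\|\delta_2,s,\delta',s')\equiv\exists\delta_1'(Trans(\delta_1,s,\delta_1',s')\land\delta'=\delta_1'\|\delta_2)\lor\exists\delta_2'(Trans(\delta_2,s,\delta_2',s')\land\delta'=\delta_1\|\delta_2')$; $Final(\alpha,s)\equiv False$; $Final(\varphi?,s)\equiv\varphi[s]$;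 $Final(\delta_1;\delta_2,s)\equiv Final(\delta_1,s)\land Final(\delta_2,s)$; $Final(\delta_1|\delta_2,s)\equiv Final(\delta_1,s)\lor Final(\delta_2,s)$; $Final(\pi x.\delta,s)\equiv\exists x.Final(\delta,s)$; $Final(\delta^*,s)\equiv True$; $Final(\delta_1\|\delta_2,s)\equiv Final(\delta_1,s)\land Final(\delta_2,s)$. $Trans^*$ is the reflexive transitive closure of $Trans$, and $Do(\delta,s,s')\doteq\exists\delta'.Trans^*(\delta,s,\delta',s')\land Final(\delta',s')$. A program $\delta$ is situation-determined in $s$ if $Trans^*(\delta,s,\delta',s')\land Trans^*(\delta,s,\delta'',s')$ implies $\delta'=\delta''$ for all $s',\delta',\delta''$. Refinement mappings: $\mathcal{D}^h$ and $\mathcal{D}^l$ are BATs with action types $\mathcal{A}^h,\mathcal{A}^l$ and fluents $\mathcal{F}^h,\mathcal{F}^l$, sharing no domain-specific symbols except $\mathcal{N}$. A refinement mapping $m$ assigns to each $A\in\mathcal{A}^h$ a situation-determined ConGolog program $m(A(\vec x))$ over the language of $\mathcal{D}^l$ whose free variables are $\vec x$, and to each $F\in\mathcal{F}^h$ a situation-suppressed formula $m(F(\vec x))$ of the language of $\mathcal{D}^l$ with free variables $\vec x$. For a high-level situation-suppressed formula $\phi$, $m(\phi)$ replaces each fluent atom $F(\vec x)$ by $m(F(\vec x))$; $m(\alpha_1,\dots,\alpha_n)=m(\alpha_1);\dots;m(\alpha_n)$ and $m(\epsilon)=nil$. $m$-bisimulation: for a model $M_h$ of $\mathcal{D}^h$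 and a model $M_l$ of $\mathcal{D}^l\cup\mathcal{C}$, situations $s_h$ of $M_h$ and $s_l$ of $M_l$ are $m$-isomorphic ($s_h\simeq_m^{M_h,M_l}s_l$) iff for every $F\in\mathcal{F}^h$ and every variable assignment $v$, $M_h,v[s/s_h]\models F(\vec x,s)$ iff $M_l,v[s/s_l]\models m(F(\vec x))[s]$. A relation $B$ between the situation domains of $M_h$ and $M_l$ is an $m$-bisimulation if every $\langle s_h,s_l\rangle\in B$ satisfies: (1) $s_h\simeq_m^{M_h,M_l}s_l$; (2) for every $A\in\mathcal{A}^h$ and assignment $v$, if some $s_h'$ has $M_h,v[s/s_h,s'/s_h']\models Poss(A(\vec x),s)\land s'=do(A(\vec x),s)$ then some $s_l'$ has $M_l,v[s/s_l,s'/s_l']\models Do(m(A(\vec x)),s,s')$ and $\langle s_h',s_l'\rangle\in B$; (3) for every $A\in\mathcal{A}^h$ and $v$, if some $s_l'$ has $M_l,v[s/s_l,s'/s_l']\models Do(m(A(\vec x)),s,s')$ then some $s_h'$ has $M_h,v[s/s_h,s'/s_h']\models Poss(A(\vec x),s)\land s'=do(A(\vec x),s)$ and $\langle s_h',s_l'\rangle\in B$. $M_h\sim_m M_l$ iff some $m$-bisimulation contains $\langle S_0^{M_h},S_0^{M_l}\rangle$. $\mathcal{D}^h$ is a sound abstraction of $\mathcal{D}^l$ relative to $m$ iff for every model $M_l$ of $\mathcal{D}^l\cup\mathcal{C}$ there is a model $M_h$ of $\mathcal{D}^h$ with $M_h\sim_m M_l$. $\textsc{any1hl}\doteq|_{A_i\in\mathcal{A}^h}\pi\vec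 x.\,m(A_i(\vec x))$ (nondeterministic choice over all high-level action types) and $\textsc{anyseqhl}\doteq\textsc{any1hl}^*$. -}

module Defs where

open import Data.Nat using (ℕ; zero; suc; _+_)
open import Data.Fin using (Fin; zero; suc)
open import Data.Vec using (Vec; []; _∷_; lookup; map; _++_)
open import Data.List using (List; []; _∷_)
open import Data.Product using (Σ; _×_; _,_; Σ-syntax)
open import Data.Sum using (_⊎_)
open import Data.Empty using (⊥)
open import Data.Unit using (⊤)
open import Relation.Nullary using (¬_)
open import Relation.Binary.PropositionalEquality using (_≡_)
open import Function.Bundles using (_⇔_)

-- Signatures: finitely many action types and fluents, each with an
-- arity (number of object arguments).  Objects are the standard names ℕ.

record Sig : Set where
  field
    nAct  : ℕ
    actAr : Fin nAct → ℕ
    nFl   : ℕ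
    flAr  : Fin nFl → ℕ
open Sig public

-- Situation-suppressed (uniform) first-order formulas with n free
-- object variables (de Bruijn indices), constants = standard names.

data Term (n : ℕ) : Set where
  var : Fin n → Term n
  nm  : ℕ → Term n

data Fm (σ : Sig) (n : ℕ) : Set where
  fl   : (F : Fin (nFl σ)) → Vec (Term n) (flAr σ F) → Fm σ n
  _≐_  : Term n → Term n → Fm σ n
  tt ff : Fm σ n
  ¬f   : Fm σ n → Fm σ n
  _∧f_ _∨f_ _⇒f_ : Fm σ n → Fm σ n → Fm σ n
  ∀f ∃f : Fm σ (suc n) → Fm σ n

Subst : ℕ → ℕ → Set
Subst n k = Fin n → Term k

wkT : ∀ {k} → Term k → Term (suc k)
wkT (var i) = var (suc i)
wkT (nm c)  = nm c

liftS : ∀ {n k} → Subst n k → Subst (suc n) (suc k)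
liftS s zero    = var zero
liftS s (suc i) = wkT (s i)

subT : ∀ {n k} → Subst n k → Term n → Term k
subT s (var i) = s i
subT s (nm c)  = nm c

subF : ∀ {σ n k} → Subst n k → Fm σ n → Fm σ k
subF s (fl F ts) = fl F (map (subT s) ts)
subF s (t ≐ u)   = subT s t ≐ subT s u
subF s tt        = tt
subF s ff        = ff
subF s (¬f φ)    = ¬f (subF s φ)
subF s (φ ∧f ψ)  = subF s φ ∧f subF s ψ
subF s (φ ∨f ψ)  = subF s φ ∨f subF s ψ
subF s (φ ⇒f ψ)  = subF s φ ⇒f subF s ψ
subF s (∀f φ)    = ∀f (subF (liftS s) φ)
subF s (∃f φ)    = ∃f (subF (liftS s) φ)

-- ConGolog programs with n free object variables (π binds variable 0)

data Prog (σ : Sig) (n : ℕ) : Set where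
  act  : (A : Fin (nAct σ)) → Vec (Term n) (actAr σ A) → Prog σ n
  test : Fm σ n → Prog σ n
  _⨾_ _∣_ _∥_ : Prog σ n → Prog σ n → Prog σ n
  π    : Prog σ (suc n) → Prog σ n
  star : Prog σ n → Prog σ n

nil : ∀ {σ n} → Prog σ n
nil = test tt

subP : ∀ {σ n k} → Subst n k → Prog σ n → Prog σ k
subP s (act A ts) = act A (map (subT s) ts)
subP s (test φ)   = test (subF s φ)
subP s (δ ⨾ γ)    = subP s δ ⨾ subP s γ
subP s (δ ∣ γ)    = subP s δ ∣ subP s γ
subP s (δ ∥ γ)    = subP s δ ∥ subP s γ
subP s (π δ)      = π (subP (liftS s) δ)
subP s (star δ)   = star (subP s δ)

inst : ∀ {σ} → Prog σ 1 → ℕ → Prog σ 0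
inst δ c = subP (λ _ → nm c) δ

closeP : ∀ {σ n} → Prog σ n → Vec ℕ n → Prog σ 0
closeP δ xs = subP (λ i → nm (lookup xs i)) δ

-- Actions and situations.  By Σ, D_ca, D_coa the situations of every model
-- are (isomorphic to) finite sequences of ground actions; do(a,s) = a ∷ s,
-- S0 = [].

Action : Sig → Set
Action σ = Σ (Fin (nAct σ)) λ A → Vec ℕ (actAr σ A)

Sit : Sig → Set
Sit σ = List (Action σ)

FVal : Sig → Set₁
FVal σ = (F : Fin (nFl σ)) → Vec ℕ (flAr σ F) → Set

evalT : ∀ {n} → Vec ℕ n → Term n → ℕ
evalT env (var i) = lookup env i
evalT env (nm c)  = c

Eval : ∀ {σ n} → FVal σ → Fm σ n → Vec ℕ n → Set
Eval I (fl F ts) env = I F (map (evalT env) ts)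
Eval I (t ≐ u)   env = evalT env t ≡ evalT env u
Eval I tt        env = ⊤
Eval I ff        env = ⊥
Eval I (¬f φ)    env = ¬ Eval I φ env
Eval I (φ ∧f ψ)  env = Eval I φ env × Eval I ψ env
Eval I (φ ∨f ψ)  env = Eval I φ env ⊎ Eval I ψ env
Eval I (φ ⇒f ψ)  env = Eval I φ env → Eval I ψ env
Eval I (∀f φ)    env = (c : ℕ) → Eval I φ (c ∷ env)
Eval I (∃f φ)    env = Σ ℕ λ c → Eval I φ (c ∷ env)

-- S0        : the axioms of D_S0 (sentences about S0, situation-suppressed)
--   poss A    : φ^Poss_A(x⃗), free variables x⃗ (arity of A)
--   ssa F A   : φ^ssa_{F,A}(y⃗,x⃗): rhs of the ssa of F instantiated with
--               action A(x⃗); variables y⃗ (arity of F) first, then x⃗.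

record BAT (σ : Sig) : Set₁ where
  field
    S0   : Fm σ 0 → Set
    poss : (A : Fin (nAct σ)) → Fm σ (actAr σ A)
    ssa  : (F : Fin (nFl σ)) (A : Fin (nAct σ)) → Fm σ (flAr σ F + actAr σ A)

-- Models of D (together with Σ, D_ca, D_coa): fluent interpretation in
-- every situation and Poss, satisfying D_S0, D_poss and D_ssa.
record Model {σ : Sig} (D : BAT σ) : Set₁ where
  field
    val    : Sit σ → FVal σ
    poss   : Action σ → Sit σ → Set
    init   : ∀ φ → BAT.S0 D φ → Eval (val []) φ []
    possAx : ∀ A xs s → poss (A , xs) s ⇔ Eval (val s) (BAT.poss D A) xs
    ssaAx  : ∀ F ys A xs s →
             val ((A , xs) ∷ s) F ys ⇔ Eval (val s) (BAT.ssa D F A) (ys ++ xs)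

-- The axioms C: Trans and Final (uniquely determined by the axioms, given
-- the model's fluents and Poss), Trans*, Do, situation-determinedness.

module Golog {σ : Sig} (val : Sit σ → FVal σ)
             (poss : Action σ → Sit σ → Set) where

  data Final : Prog σ 0 → Sit σ → Set where
    fTest  : ∀ {φ s} → Eval (val s) φ [] → Final (test φ) s
    fSeq   : ∀ {δ γ s} → Final δ s → Final γ s → Final (δ ⨾ γ) s
    fOrL   : ∀ {δ γ s} → Final δ s → Final (δ ∣ γ) s
    fOrR   : ∀ {δ γ s} → Final γ s → Final (δ ∣ γ) s
    fPi    : ∀ {δ s} (c : ℕ) → Final (inst δ c) s → Final (π δ) s
    fStar  : ∀ {δ s} → Final (star δ) s
    fPar   : ∀ {δ γ s} → Final δ s → Final γ s → Final (δ ∥ γ) s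

  data Trans : Prog σ 0 → Sit σ → Prog σ 0 → Sit σ → Set where
    tAct  : ∀ {A ts s} → poss (A , map (evalT []) ts) s →
            Trans (act A ts) s nil ((A , map (evalT []) ts) ∷ s)
    tSeq1 : ∀ {δ γ δ' s s'} → Trans δ s δ' s' → Trans (δ ⨾ γ) s (δ' ⨾ γ) s'
    tSeq2 : ∀ {δ γ γ' s s'} → Final δ s → Trans γ s γ' s' →
            Trans (δ ⨾ γ) s γ' s'
    tOrL  : ∀ {δ γ δ' s s'} → Trans δ s δ' s' → Trans (δ ∣ γ) s δ' s'
    tOrR  : ∀ {δ γ δ' s s'} → Trans γ s δ' s' → Trans (δ ∣ γ) s δ' s'
    tPi   : ∀ {δ δ' s s'} (c : ℕ) → Trans (inst δ c) s δ' s' →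
            Trans (π δ) s δ' s'
    tStar : ∀ {δ δ' s s'} → Trans δ s δ' s' →
            Trans (star δ) s (δ' ⨾ star δ) s'
    tParL : ∀ {δ γ δ' s s'} → Trans δ s δ' s' →
            Trans (δ ∥ γ) s (δ' ∥ γ) s'
    tParR : ∀ {δ γ γ' s s'} → Trans γ s γ' s' →
            Trans (δ ∥ γ) s (δ ∥ γ') s'

  data Trans* : Prog σ 0 → Sit σ → Prog σ 0 → Sit σ → Set where
    ε*   : ∀ {δ s} → Trans* δ s δ s
    _◅_  : ∀ {δ s δ₁ s₁ δ' s'} → Trans δ s δ₁ s₁ → Trans* δ₁ s₁ δ' s' →
           Trans* δ s δ' s'

  Do : Prog σ 0 → Sit σ → Sit σ → Set
  Do δ s s' = Σ[ δ' ∈ Prog σ 0 ] (Trans* δ s δ' s' × Final δ' s')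

  SitDetermined : Prog σ 0 → Sit σ → Set
  SitDetermined δ s = ∀ {s' δ' δ''} → Trans* δ s δ' s' → Trans* δ s δ'' s' →
                      δ' ≡ δ''

DoM : ∀ {σ} {D : BAT σ} → Model D → Prog σ 0 → Sit σ → Sit σ → Set
DoM M = Golog.Do (Model.val M) (Model.poss M)

record Refinement (σh : Sig) {σl : Sig} (Dl : BAT σl) : Set₁ where
  field
    mAct   : (A : Fin (nAct σh)) → Prog σl (actAr σh A)
    mFl    : (F : Fin (nFl σh)) → Fm σl (flAr σh F)
    sitDet : (M : Model Dl) (A : Fin (nAct σh)) (xs : Vec ℕ (actAr σh A))
             (s : Sit σl) →
             Golog.SitDetermined (Model.val M) (Model.poss M)
               (closeP (mAct A) xs) s

choiceFin : ∀ {σ} (n : ℕ) → (Fin n → Prog σ 0) → Prog σ 0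
choiceFin zero f = test ff
choiceFin (suc zero) f = f zero
choiceFin (suc (suc n)) f = f zero ∣ choiceFin (suc n) (λ i → f (suc i))

pis : ∀ {σ} (n : ℕ) → Prog σ n → Prog σ 0
pis zero δ = δ
pis (suc n) δ = pis n (π δ)

module _ {σh σl : Sig} (Dh : BAT σh) (Dl : BAT σl) (m : Refinement σh Dl) where
  open Refinement m

  mA : (A : Fin (nAct σh)) → Vec ℕ (actAr σh A) → Prog σl 0
  mA A xs = closeP (mAct A) xs

  mFm : ∀ {n} → Fm σh n → Fm σl n
  mFm (fl F ts) = subF (λ i → lookup ts i) (mFl F)
  mFm (t ≐ u)   = t ≐ u
  mFm tt        = tt
  mFm ff        = ff
  mFm (¬f φ)    = ¬f (mFm φ)
  mFm (φ ∧f ψ)  = mFm φ ∧f mFm ψ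
  mFm (φ ∨f ψ)  = mFm φ ∨f mFm ψ
  mFm (φ ⇒f ψ)  = mFm φ ⇒f mFm ψ
  mFm (∀f φ)    = ∀f (mFm φ)
  mFm (∃f φ)    = ∃f (mFm φ)

  any1hl : Prog σl 0
  any1hl = choiceFin (nAct σh) (λ A → pis (actAr σh A) (mAct A))

  anyseqhl : Prog σl 0
  anyseqhl = star any1hl

  module _ (Mh : Model Dh) (Ml : Model Dl) where

    MIso : Sit σh → Sit σl → Set
    MIso sh sl = ∀ F ys →
      Model.val Mh sh F ys ⇔ Eval (Model.val Ml sl) (mFl F) ys

    IsBisim : (Sit σh → Sit σl → Set) → Set
    IsBisim B = ∀ {sh sl} → B sh sl →
        MIso sh sl
      × (∀ A xs → Model.poss Mh (A , xs) sh →
           Σ[ sl' ∈ Sit σl ] (DoM Ml (mA A xs) sl sl' × B ((A , xs) ∷ sh) sl'))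
      × (∀ A xs sl' → DoM Ml (mA A xs) sl sl' →
           Model.poss Mh (A , xs) sh × B ((A , xs) ∷ sh) sl')

    Bisimilar : Set₁
    Bisimilar = Σ[ B ∈ (Sit σh → Sit σl → Set) ] (IsBisim B × B [] [])

  SoundAbstraction : Set₁
  SoundAbstraction = (Ml : Model Dl) → Σ[ Mh ∈ Model Dh ] Bisimilar Mh Ml

  CondA : Set₁
  CondA = ∀ φ → BAT.S0 Dh φ →
          (I : FVal σl) → (∀ ψ → BAT.S0 Dl ψ → Eval I ψ []) →
          Eval I (mFm φ) []

  CondB : Set₁
  CondB = (Ml : Model Dl) (s : Sit σl) → DoM Ml anyseqhl [] s →
          ∀ A xs →
          Eval (Model.val Ml s) (mFm (BAT.poss Dh A)) xs
            ⇔ (Σ[ s' ∈ Sit σl ] DoM Ml (mA A xs) s s')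

  CondC : Set₁
  CondC = (Ml : Model Dl) (s : Sit σl) → DoM Ml anyseqhl [] s →
          ∀ A xs s' → DoM Ml (mA A xs) s s' →
          ∀ F ys →
          Eval (Model.val Ml s) (mFm (BAT.ssa Dh F A)) (ys ++ xs)
            ⇔ Eval (Model.val Ml s') (Refinement.mFl m F) ys

-- Interpretations that are m-isomorphic agree on every high-level formula φ and its
-- translation m(φ).  If D^h is a sound abstraction, a low-level model is built from
-- any interpretation satisfying D^l_S0 (by progression through the successor state
-- axioms); its bisimilar high-level model satisfies D^h_S0 and is m-isomorphic at S0,
-- which gives (a).  Every situation reached by anyseqhl is bisimilar to a high-level
-- situation, and there the precondition and successor state axioms of D^h translate
-- into (b) and (c).  Conversely, progression from the m-image of the low-level initial
-- state gives a high-level model (by (a)), and "reached by anyseqhl and m-isomorphic"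
-- is an m-bisimulation: (b) matches high-level executability with low-level runs of
-- m(A(x⃗)), and (c) propagates the m-isomorphism along them.
module Submission where

open import Defs
open import Data.Product using (_×_)
open import Function.Bundles using (_⇔_)

open import Data.Nat using (ℕ; zero; suc)
open import Data.Fin using (Fin; zero; suc)
open import Data.Vec using (Vec; []; _∷_; lookup; map; _++_)
open import Data.Vec.Properties using (map-∘; map-cong; map-id; lookup-map)
open import Data.List using ([]; _∷_)
open import Data.Product using (∃; _,_; Σ-syntax; proj₁; proj₂)
open import Data.Product.Function.NonDependent.Propositional using (_×-⇔_)
open import Data.Sum using (_⊎_; inj₁; inj₂; [_,_])
open import Data.Sum.Function.Propositional using (_⊎-⇔_)
open import Data.Empty using (⊥; ⊥-elim)
open import Function.Base using (_∘_)
open import Function.Bundles using (mk⇔; Equivalence)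
open import Function.Properties.Equivalence as ⇔ using ()
open import Function.Related.TypeIsomorphisms using (→-cong-⇔; ¬-cong-⇔)
open import Relation.Binary.Construct.Closure.ReflexiveTransitive
  using (Star; ε; _◅_; _◅◅_)
open import Relation.Binary.PropositionalEquality
  using (_≡_; refl; sym; trans; cong; cong₂; subst)
open Equivalence using (to; from)

∀-cong-⇔ : {P Q : ℕ → Set} → (∀ c → P c ⇔ Q c) → ((c : ℕ) → P c) ⇔ ((c : ℕ) → Q c)
∀-cong-⇔ P⇔Q = mk⇔ (λ p c → to (P⇔Q c) (p c)) (λ q c → from (P⇔Q c) (q c))

∃-cong-⇔ : {P Q : ℕ → Set} → (∀ c → P c ⇔ Q c) → ∃ P ⇔ ∃ Q
∃-cong-⇔ P⇔Q = mk⇔ (λ (c , p) → c , to (P⇔Q c) p) (λ (c , q) → c , from (P⇔Q c) q)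

≡⇒⇔ : {A B : Set} → A ≡ B → A ⇔ B
≡⇒⇔ refl = ⇔.refl

EvalSubst : ∀ {n k} → Subst n k → Vec ℕ k → Vec ℕ n → Set
EvalSubst s env env′ = ∀ i → lookup env′ i ≡ evalT env (s i)

evalT-wkT : ∀ {k} c (env : Vec ℕ k) t → evalT (c ∷ env) (wkT t) ≡ evalT env t
evalT-wkT c env (var i) = refl
evalT-wkT c env (nm x)  = refl

EvalSubst-liftS : ∀ {n k} {s : Subst n k} {env env′} → EvalSubst s env env′ →
                  ∀ c → EvalSubst (liftS s) (c ∷ env) (c ∷ env′)
EvalSubst-liftS h c zero    = refl
EvalSubst-liftS {s = s} {env} h c (suc i) = trans (h i) (sym (evalT-wkT c env (s i)))

evalT-subT : ∀ {n k} {s : Subst n k} {env env′} → EvalSubst s env env′ →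
             ∀ t → evalT env (subT s t) ≡ evalT env′ t
evalT-subT h (var i) = sym (h i)
evalT-subT h (nm c)  = refl

Eval-subF : ∀ {σ n k} (I : FVal σ) {s : Subst n k} {env env′} → EvalSubst s env env′ →
            (φ : Fm σ n) → Eval I (subF s φ) env ⇔ Eval I φ env′
Eval-subF I {s} {env} h (fl F ts) =
  ≡⇒⇔ (cong (I F) (trans (sym (map-∘ (evalT env) (subT s) ts)) (map-cong (evalT-subT h) ts)))
Eval-subF I h (t ≐ u)  = ≡⇒⇔ (cong₂ _≡_ (evalT-subT h t) (evalT-subT h u))
Eval-subF I h tt       = ⇔.refl
Eval-subF I h ff       = ⇔.refl
Eval-subF I h (¬f φ)   = ¬-cong-⇔ (Eval-subF I h φ)
Eval-subF I h (φ ∧f ψ) = Eval-subF I h φ ×-⇔ Eval-subF I h ψ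
Eval-subF I h (φ ∨f ψ) = Eval-subF I h φ ⊎-⇔ Eval-subF I h ψ
Eval-subF I h (φ ⇒f ψ) = →-cong-⇔ (Eval-subF I h φ) (Eval-subF I h ψ)
Eval-subF I h (∀f φ)   = ∀-cong-⇔ λ c → Eval-subF I (EvalSubst-liftS h c) φ
Eval-subF I h (∃f φ)   = ∃-cong-⇔ λ c → Eval-subF I (EvalSubst-liftS h c) φ

Composes : ∀ {n k j} → Subst k j → Subst n k → Subst n j → Set
Composes s t u = ∀ i → subT s (t i) ≡ u i

subT-liftS-wkT : ∀ {n k} (s : Subst n k) t → subT (liftS s) (wkT t) ≡ wkT (subT s t)
subT-liftS-wkT s (var i) = refl
subT-liftS-wkT s (nm c)  = refl

Composes-liftS : ∀ {n k j} {s : Subst k j} {t : Subst n k} {u : Subst n j} →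
                 Composes s t u → Composes (liftS s) (liftS t) (liftS u)
Composes-liftS h zero = refl
Composes-liftS {s = s} {t} h (suc i) = trans (subT-liftS-wkT s (t i)) (cong wkT (h i))

module _ {n k j} {s : Subst k j} {t : Subst n k} {u : Subst n j} (h : Composes s t u) where

  subT-∘ : ∀ x → subT s (subT t x) ≡ subT u x
  subT-∘ (var i) = h i
  subT-∘ (nm c)  = refl

  map-subT-∘ : ∀ {m} (ts : Vec (Term n) m) → map (subT s) (map (subT t) ts) ≡ map (subT u) ts
  map-subT-∘ ts = trans (sym (map-∘ (subT s) (subT t) ts)) (map-cong subT-∘ ts)

subF-∘ : ∀ {σ n k j} {s : Subst k j} {t : Subst n k} {u : Subst n j} →
         Composes s t u → (φ : Fm σ n) → subF s (subF t φ) ≡ subF u φ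
subF-∘ h (fl F ts) = cong (fl F) (map-subT-∘ h ts)
subF-∘ h (x ≐ y)   = cong₂ _≐_ (subT-∘ h x) (subT-∘ h y)
subF-∘ h tt        = refl
subF-∘ h ff        = refl
subF-∘ h (¬f φ)    = cong ¬f (subF-∘ h φ)
subF-∘ h (φ ∧f ψ)  = cong₂ _∧f_ (subF-∘ h φ) (subF-∘ h ψ)
subF-∘ h (φ ∨f ψ)  = cong₂ _∨f_ (subF-∘ h φ) (subF-∘ h ψ)
subF-∘ h (φ ⇒f ψ)  = cong₂ _⇒f_ (subF-∘ h φ) (subF-∘ h ψ)
subF-∘ h (∀f φ)    = cong ∀f (subF-∘ (Composes-liftS h) φ)
subF-∘ h (∃f φ)    = cong ∃f (subF-∘ (Composes-liftS h) φ)

subP-∘ : ∀ {σ n k j} {s : Subst k j} {t : Subst n k} {u : Subst n j} →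
         Composes s t u → (δ : Prog σ n) → subP s (subP t δ) ≡ subP u δ
subP-∘ h (act A ts) = cong (act A) (map-subT-∘ h ts)
subP-∘ h (test φ)   = cong test (subF-∘ h φ)
subP-∘ h (δ ⨾ γ)    = cong₂ _⨾_ (subP-∘ h δ) (subP-∘ h γ)
subP-∘ h (δ ∣ γ)    = cong₂ _∣_ (subP-∘ h δ) (subP-∘ h γ)
subP-∘ h (δ ∥ γ)    = cong₂ _∥_ (subP-∘ h δ) (subP-∘ h γ)
subP-∘ h (π δ)      = cong π (subP-∘ (Composes-liftS h) δ)
subP-∘ h (star δ)   = cong star (subP-∘ h δ)

IsIdentity : ∀ {n} → Subst n n → Set
IsIdentity s = ∀ i → s i ≡ var i

IsIdentity-liftS : ∀ {n} {s : Subst n n} → IsIdentity s → IsIdentity (liftS s)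
IsIdentity-liftS h zero    = refl
IsIdentity-liftS h (suc i) = cong wkT (h i)

module _ {n} {s : Subst n n} (h : IsIdentity s) where

  subT-id : ∀ x → subT s x ≡ x
  subT-id (var i) = h i
  subT-id (nm c)  = refl

  map-subT-id : ∀ {m} (ts : Vec (Term n) m) → map (subT s) ts ≡ ts
  map-subT-id ts = trans (map-cong subT-id ts) (map-id ts)

subF-id : ∀ {σ n} {s : Subst n n} → IsIdentity s → (φ : Fm σ n) → subF s φ ≡ φ
subF-id h (fl F ts) = cong (fl F) (map-subT-id h ts)
subF-id h (x ≐ y)   = cong₂ _≐_ (subT-id h x) (subT-id h y)
subF-id h tt        = refl
subF-id h ff        = refl
subF-id h (¬f φ)    = cong ¬f (subF-id h φ)
subF-id h (φ ∧f ψ)  = cong₂ _∧f_ (subF-id h φ) (subF-id h ψ)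
subF-id h (φ ∨f ψ)  = cong₂ _∨f_ (subF-id h φ) (subF-id h ψ)
subF-id h (φ ⇒f ψ)  = cong₂ _⇒f_ (subF-id h φ) (subF-id h ψ)
subF-id h (∀f φ)    = cong ∀f (subF-id (IsIdentity-liftS h) φ)
subF-id h (∃f φ)    = cong ∃f (subF-id (IsIdentity-liftS h) φ)

subP-id : ∀ {σ n} {s : Subst n n} → IsIdentity s → (δ : Prog σ n) → subP s δ ≡ δ
subP-id h (act A ts) = cong (act A) (map-subT-id h ts)
subP-id h (test φ)   = cong test (subF-id h φ)
subP-id h (δ ⨾ γ)    = cong₂ _⨾_ (subP-id h δ) (subP-id h γ)
subP-id h (δ ∣ γ)    = cong₂ _∣_ (subP-id h δ) (subP-id h γ)
subP-id h (δ ∥ γ)    = cong₂ _∥_ (subP-id h δ) (subP-id h γ)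
subP-id h (π δ)      = cong π (subP-id (IsIdentity-liftS h) δ)
subP-id h (star δ)   = cong star (subP-id h δ)

closeP-[] : ∀ {σ} (δ : Prog σ 0) → closeP δ [] ≡ δ
closeP-[] = subP-id λ ()

closeP-∷ : ∀ {σ n} (δ : Prog σ (suc n)) c (xs : Vec ℕ n) →
           inst (subP (liftS (λ i → nm (lookup xs i))) δ) c ≡ closeP δ (c ∷ xs)
closeP-∷ δ c xs = subP-∘ composes δ
  where
  composes : Composes (λ _ → nm c) (liftS (λ i → nm (lookup xs i)))
                      (λ i → nm (lookup (c ∷ xs) i))
  composes zero    = refl
  composes (suc i) = refl

module Runs {σ : Sig} (val : Sit σ → FVal σ) (poss : Action σ → Sit σ → Set) where
  open Golog val poss

  Do-⊆ : ∀ {δ γ s s′} → (∀ {δ′ s₁} → Trans δ s δ′ s₁ → Trans γ s δ′ s₁) →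
         (Final δ s → Final γ s) → Do δ s s′ → Do γ s s′
  Do-⊆ trans⊆ final⊆ (_ , ε*     , f) = _ , ε* , final⊆ f
  Do-⊆ trans⊆ final⊆ (_ , t ◅ r  , f) = _ , trans⊆ t ◅ r , f

  Do-False⁻ : ∀ {s s′} → Do (test ff) s s′ → ⊥
  Do-False⁻ (_ , ε*     , fTest ())
  Do-False⁻ (_ , () ◅ _ , _)

  Do-π⁺ : ∀ {γ s s′} c → Do (inst γ c) s s′ → Do (π γ) s s′
  Do-π⁺ c = Do-⊆ (tPi c) (fPi c)

  Do-π⁻ : ∀ {γ s s′} → Do (π γ) s s′ → ∃ λ c → Do (inst γ c) s s′
  Do-π⁻ (_ , ε*           , fPi c f) = c , _ , ε* , f
  Do-π⁻ (_ , tPi c t ◅ r  , f)       = c , _ , t ◅ r , f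

  Do-∣⁻ : ∀ {δ γ s s′} → Do (δ ∣ γ) s s′ → Do δ s s′ ⊎ Do γ s s′
  Do-∣⁻ (_ , ε*         , fOrL f) = inj₁ (_ , ε* , f)
  Do-∣⁻ (_ , ε*         , fOrR f) = inj₂ (_ , ε* , f)
  Do-∣⁻ (_ , tOrL t ◅ r , f)      = inj₁ (_ , t ◅ r , f)
  Do-∣⁻ (_ , tOrR t ◅ r , f)      = inj₂ (_ , t ◅ r , f)

  Do-choiceFin⁺ : ∀ n (f : Fin n → Prog σ 0) i {s s′} → Do (f i) s s′ → Do (choiceFin n f) s s′
  Do-choiceFin⁺ (suc zero)    f zero    d = d
  Do-choiceFin⁺ (suc (suc n)) f zero    d = Do-⊆ tOrL fOrL d
  Do-choiceFin⁺ (suc (suc n)) f (suc i) d =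
    Do-⊆ tOrR fOrR (Do-choiceFin⁺ (suc n) (f ∘ suc) i d)

  Do-choiceFin⁻ : ∀ n (f : Fin n → Prog σ 0) {s s′} → Do (choiceFin n f) s s′ →
                  ∃ λ i → Do (f i) s s′
  Do-choiceFin⁻ zero          f d = ⊥-elim (Do-False⁻ d)
  Do-choiceFin⁻ (suc zero)    f d = zero , d
  Do-choiceFin⁻ (suc (suc n)) f d =
    [ (λ d₀ → zero , d₀)
    , (λ d′ → let i , dᵢ = Do-choiceFin⁻ (suc n) (f ∘ suc) d′ in suc i , dᵢ)
    ] (Do-∣⁻ d)

  Do-pis⁺ : ∀ n (δ : Prog σ n) xs {s s′} → Do (closeP δ xs) s s′ → Do (pis n δ) s s′
  Do-pis⁺ zero    δ []       d = subst (λ p → Do p _ _) (closeP-[] δ) d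
  Do-pis⁺ (suc n) δ (c ∷ xs) d =
    Do-pis⁺ n (π δ) xs (Do-π⁺ c (subst (λ p → Do p _ _) (sym (closeP-∷ δ c xs)) d))

  Do-pis⁻ : ∀ n (δ : Prog σ n) {s s′} → Do (pis n δ) s s′ → ∃ λ xs → Do (closeP δ xs) s s′
  Do-pis⁻ zero    δ d = [] , subst (λ p → Do p _ _) (sym (closeP-[] δ)) d
  Do-pis⁻ (suc n) δ d with Do-pis⁻ n (π δ) d
  ... | xs , d′ with Do-π⁻ d′
  ...   | c , d″ = c ∷ xs , subst (λ p → Do p _ _) (closeP-∷ δ c xs) d″

  Do-⨾⁺ : ∀ {δ γ s s₁ s₂} → Do δ s s₁ → Do γ s₁ s₂ → Do (δ ⨾ γ) s s₂
  Do-⨾⁺ (_ , ε* , fδ) (_ , ε*    , fγ) = _ , ε* , fSeq fδ fγ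
  Do-⨾⁺ (_ , ε* , fδ) (_ , t ◅ r , fγ) = _ , tSeq2 fδ t ◅ r , fγ
  Do-⨾⁺ (_ , t ◅ r , fδ) e with Do-⨾⁺ (_ , r , fδ) e
  ... | δ′ , r′ , f = δ′ , tSeq1 t ◅ r′ , f

  Do-star⁺ : ∀ {δ s s′} → Star (Do δ) s s′ → Do (star δ) s s′
  Do-star⁺ ε = _ , ε* , fStar
  Do-star⁺ ((_ , ε*    , _) ◅ ds) = Do-star⁺ ds
  Do-star⁺ ((_ , t ◅ r , f) ◅ ds) with Do-⨾⁺ (_ , r , f) (Do-star⁺ ds)
  ... | δ′ , r′ , f′ = δ′ , tStar t ◅ r′ , f′

  -- The continuation carries the already-executed prefix of the current iteration of δ,
  -- so both functions recurse structurally on the single trace of δ*.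
  Do-star⁻ : ∀ {δ s s′} → Do (star δ) s s′ → Star (Do δ) s s′
  Do-star⁻ {δ} (_ , ε* , _)    = ε
  Do-star⁻ {δ} (_ , t ◅ r , f) = iteration ε t r f
    where
    mutual
      iteration : ∀ {s₀ s δ₁ s₁ δ′ s′} → Star (Do δ) s₀ s →
                  Trans (star δ) s δ₁ s₁ → Trans* δ₁ s₁ δ′ s′ → Final δ′ s′ →
                  Star (Do δ) s₀ s′
      iteration done (tStar t) r f =
        remainder (λ r′ f′ → done ◅◅ ((_ , t ◅ r′ , f′) ◅ ε)) r f

      remainder : ∀ {s₀ γ s₁ δ′ s′} →
                  (∀ {γ′ s₂} → Trans* γ s₁ γ′ s₂ → Final γ′ s₂ → Star (Do δ) s₀ s₂) →
                  Trans* (γ ⨾ star δ) s₁ δ′ s′ → Final δ′ s′ → Star (Do δ) s₀ s′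
      remainder k ε*                (fSeq fγ _) = k ε* fγ
      remainder k (tSeq1 t ◅ r)     f           = remainder (λ r′ → k (t ◅ r′)) r f
      remainder k (tSeq2 fγ t ◅ r)  f           = iteration (k ε* fγ) t r f

-- The model of a basic action theory determined by its initial state

module Progression {σ : Sig} (D : BAT σ) (I : FVal σ) where

  val : Sit σ → FVal σ
  val []             = I
  val ((A , xs) ∷ s) F ys = Eval (val s) (BAT.ssa D F A) (ys ++ xs)

  poss : Action σ → Sit σ → Set
  poss (A , xs) s = Eval (val s) (BAT.poss D A) xs

  model : (∀ φ → BAT.S0 D φ → Eval I φ []) → Model D
  model init = record
    { val    = val
    ; poss   = poss
    ; init   = init
    ; possAx = λ _ _ _ → ⇔.refl
    ; ssaAx  = λ _ _ _ _ _ → ⇔.refl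
    }

module _ {σh σl : Sig} (Dh : BAT σh) (Dl : BAT σl) (m : Refinement σh Dl) where
  open Refinement m

  MIsoVal : FVal σh → FVal σl → Set
  MIsoVal Ih Il = ∀ F ys → Ih F ys ⇔ Eval Il (mFl F) ys

  Eval-mFm : ∀ {Ih Il} → MIsoVal Ih Il →
             ∀ {n} (φ : Fm σh n) env → Eval Ih φ env ⇔ Eval Il (mFm Dh Dl m φ) env
  Eval-mFm {Il = Il} iso (fl F ts) env =
    ⇔.trans (iso F _) (⇔.sym (Eval-subF Il (λ i → lookup-map i (evalT env) ts) (mFl F)))
  Eval-mFm iso (t ≐ u)  env = ⇔.refl
  Eval-mFm iso tt       env = ⇔.refl
  Eval-mFm iso ff       env = ⇔.refl
  Eval-mFm iso (¬f φ)   env = ¬-cong-⇔ (Eval-mFm iso φ env)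
  Eval-mFm iso (φ ∧f ψ) env = Eval-mFm iso φ env ×-⇔ Eval-mFm iso ψ env
  Eval-mFm iso (φ ∨f ψ) env = Eval-mFm iso φ env ⊎-⇔ Eval-mFm iso ψ env
  Eval-mFm iso (φ ⇒f ψ) env = →-cong-⇔ (Eval-mFm iso φ env) (Eval-mFm iso ψ env)
  Eval-mFm iso (∀f φ)   env = ∀-cong-⇔ λ c → Eval-mFm iso φ (c ∷ env)
  Eval-mFm iso (∃f φ)   env = ∃-cong-⇔ λ c → Eval-mFm iso φ (c ∷ env)

  module _ (Ml : Model Dl) where
    open Runs (Model.val Ml) (Model.poss Ml)

    Do-any1hl⁺ : ∀ A xs {s s′} → DoM Ml (mA Dh Dl m A xs) s s′ → DoM Ml (any1hl Dh Dl m) s s′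
    Do-any1hl⁺ A xs d = Do-choiceFin⁺ (nAct σh) _ A (Do-pis⁺ (actAr σh A) (mAct A) xs d)

    Do-any1hl⁻ : ∀ {s s′} → DoM Ml (any1hl Dh Dl m) s s′ →
                 Σ[ A ∈ Fin (nAct σh) ] ∃ λ xs → DoM Ml (mA Dh Dl m A xs) s s′
    Do-any1hl⁻ d = let A , d′ = Do-choiceFin⁻ (nAct σh) _ d in A , Do-pis⁻ (actAr σh A) (mAct A) d′

    module _ (Mh : Model Dh) {B : Sit σh → Sit σl → Set} (isB : IsBisim Dh Dl m Mh Ml B) where

      bisimilar-along-any1hl : ∀ {sh s s′} → B sh s → Star (DoM Ml (any1hl Dh Dl m)) s s′ →
                               ∃ λ sh′ → B sh′ s′
      bisimilar-along-any1hl b ε        = _ , b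
      bisimilar-along-any1hl b (d ◅ ds) =
        let A , xs , e = Do-any1hl⁻ d
            _ , _ , matchLow = isB b
        in bisimilar-along-any1hl (proj₂ (matchLow A xs _ e)) ds

      possAx-at-bisimilar : ∀ {sh s} → B sh s → ∀ A xs →
        Eval (Model.val Ml s) (mFm Dh Dl m (BAT.poss Dh A)) xs
          ⇔ (Σ[ s′ ∈ Sit σl ] DoM Ml (mA Dh Dl m A xs) s s′)
      possAx-at-bisimilar {sh} b A xs =
        let iso , matchHigh , matchLow = isB b
        in ⇔.trans (⇔.sym (Eval-mFm iso (BAT.poss Dh A) xs))
          (⇔.trans (⇔.sym (Model.possAx Mh A xs sh))
            (mk⇔ (λ p → let s′ , e , _ = matchHigh A xs p in s′ , e)
                 (λ (s′ , e) → proj₁ (matchLow A xs s′ e))))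

      ssaAx-at-bisimilar : ∀ {sh s} → B sh s → ∀ A xs s′ → DoM Ml (mA Dh Dl m A xs) s s′ →
        ∀ F ys → Eval (Model.val Ml s) (mFm Dh Dl m (BAT.ssa Dh F A)) (ys ++ xs)
                   ⇔ Eval (Model.val Ml s′) (mFl F) ys
      ssaAx-at-bisimilar {sh} b A xs s′ e F ys =
        let iso , _ , matchLow = isB b
            iso′ , _ = isB (proj₂ (matchLow A xs s′ e))
        in ⇔.trans (⇔.sym (Eval-mFm iso (BAT.ssa Dh F A) (ys ++ xs)))
             (⇔.trans (⇔.sym (Model.ssaAx Mh F ys A xs sh)) (iso′ F ys))

    module _ (condA : CondA Dh Dl m) (condB : CondB Dh Dl m) (condC : CondC Dh Dl m) where

      mImageOfS₀ : FVal σh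
      mImageOfS₀ F ys = Eval (Model.val Ml []) (mFl F) ys

      abstractModel : Model Dh
      abstractModel = Progression.model Dh mImageOfS₀ λ φ φ∈ →
        from (Eval-mFm (λ _ _ → ⇔.refl) φ []) (condA φ φ∈ (Model.val Ml []) (Model.init Ml))

      ReachedAndIso : Sit σh → Sit σl → Set
      ReachedAndIso sh sl = Star (DoM Ml (any1hl Dh Dl m)) [] sl
                          × MIsoVal (Model.val abstractModel sh) (Model.val Ml sl)

      ReachedAndIso-isBisim : IsBisim Dh Dl m abstractModel Ml ReachedAndIso
      ReachedAndIso-isBisim {sh} {sl} (reached , iso) = iso , matchHigh , matchLow
        where
        run : DoM Ml (anyseqhl Dh Dl m) [] sl
        run = Do-star⁺ reached

        step : ∀ A xs sl′ → DoM Ml (mA Dh Dl m A xs) sl sl′ → ReachedAndIso ((A , xs) ∷ sh) sl′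
        step A xs sl′ e = reached ◅◅ (Do-any1hl⁺ A xs e ◅ ε)
                        , λ F ys → ⇔.trans (Eval-mFm iso (BAT.ssa Dh F A) (ys ++ xs))
                                           (condC Ml sl run A xs sl′ e F ys)

        executable⇔ : ∀ A xs → Model.poss abstractModel (A , xs) sh
                                 ⇔ (Σ[ sl′ ∈ Sit σl ] DoM Ml (mA Dh Dl m A xs) sl sl′)
        executable⇔ A xs = ⇔.trans (Eval-mFm iso (BAT.poss Dh A) xs) (condB Ml sl run A xs)

        matchHigh : ∀ A xs → Model.poss abstractModel (A , xs) sh →
                    Σ[ sl′ ∈ Sit σl ] (DoM Ml (mA Dh Dl m A xs) sl sl′
                                       × ReachedAndIso ((A , xs) ∷ sh) sl′)
        matchHigh A xs p = let sl′ , e = to (executable⇔ A xs) p in sl′ , e , step A xs sl′ e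

        matchLow : ∀ A xs sl′ → DoM Ml (mA Dh Dl m A xs) sl sl′ →
                   Model.poss abstractModel (A , xs) sh × ReachedAndIso ((A , xs) ∷ sh) sl′
        matchLow A xs sl′ e = from (executable⇔ A xs) (sl′ , e) , step A xs sl′ e

      abstractModel-bisimilar : Bisimilar Dh Dl m abstractModel Ml
      abstractModel-bisimilar =
        ReachedAndIso , (λ {sh} {sl} → ReachedAndIso-isBisim {sh} {sl}) , ε , λ _ _ → ⇔.refl

  sound⇒conditions : SoundAbstraction Dh Dl m → CondA Dh Dl m × CondB Dh Dl m × CondC Dh Dl m
  sound⇒conditions sound = condA , condB , condC
    where
    condA : CondA Dh Dl m
    condA φ φ∈ I I⊨ =
      let Mh , _ , isB , b₀ = sound (Progression.model Dl I I⊨)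
      in to (Eval-mFm (proj₁ (isB b₀)) φ []) (Model.init Mh φ φ∈)

    condB : CondB Dh Dl m
    condB Ml s run =
      let Mh , _ , isB , b₀ = sound Ml
          _ , b = bisimilar-along-any1hl Ml Mh isB b₀ (Runs.Do-star⁻ _ _ run)
      in possAx-at-bisimilar Ml Mh isB b

    condC : CondC Dh Dl m
    condC Ml s run =
      let Mh , _ , isB , b₀ = sound Ml
          _ , b = bisimilar-along-any1hl Ml Mh isB b₀ (Runs.Do-star⁻ _ _ run)
      in ssaAx-at-bisimilar Ml Mh isB b

  conditions⇒sound : CondA Dh Dl m × CondB Dh Dl m × CondC Dh Dl m → SoundAbstraction Dh Dl m
  conditions⇒sound (condA , condB , condC) Ml =
    abstractModel Ml condA condB condC , abstractModel-bisimilar Ml condA condB condC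

theorem4 : {σh σl : Sig} (Dh : BAT σh) (Dl : BAT σl) (m : Refinement σh Dl) →
    SoundAbstraction Dh Dl m ⇔ (CondA Dh Dl m × CondB Dh Dl m × CondC Dh Dl m)
theorem4 Dh Dl m = mk⇔ (sound⇒conditions Dh Dl m) (conditions⇒sound Dh Dl m)
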